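{- Let $G$ be a finite graph admitting a nowhere-zero $4$-flow. Then $G$ has a $3$-removable set $R\subseteq E(G)$ such that $|R|\le \frac{1}{6}|E(G)|$.
   Context: For an integer $k\ge 2$, a $k$-flow on an orientation $\vec{G}$ of a graph $G$ is a function $\psi\colon E(\vec{G})\to\mathbb{Z}$ such that at every vertex the sum of incoming flow values equals the sum of outgoing flow values, and $|\psi(z)|\le k-1$ for every arc $z$. It is a nowhere-zero $k$-flow ($k$-NZF) if moreover $\psi(z)\neq 0$ for all arcs $z$. A graph has a $k$-NZF if some orientation of it has one. A set $R\subseteq E(G)$ is called $k$-removable if $G-R$ (the graph obtained by deleting the edges of $R$) has a nowhere-zero $k$-flow. -}

module Defs where

open import Data.Nat using (ℕ; zero; suc; pred) renaming (_≤_ to _≤ℕ_)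
open import Data.Integer using (ℤ; +_; _+_; ∣_∣)
open import Data.Fin using (Fin)
open import Data.Fin.Subset using (Subset; _∈_; _∉_)
open import Data.Bool using (Bool; true; false; if_then_else_)
open import Data.Product using (_×_; _,_; proj₁; proj₂)
open import Data.List using (List; []; _∷_; length; lookup; map; foldr; allFin)
open import Relation.Nullary using (¬_)
open import Relation.Binary.PropositionalEquality using (_≡_)
open import Data.Vec using (Vec)
import Data.Vec as V

-- A finite (multi)graph on vertex set Fin n: a list of edges, each given by
-- its two endpoints (parallel edges and loops allowed). The pair (u , v)
-- also serves as a reference orientation u → v.
record Graph : Set where
  constructor graph
  field
    n     : ℕ
    edges : List (Fin n × Fin n)

open Graph public

E : Graph → Set
E G = Fin (length (edges G))

-- an orientation: for each edge, whether it is reversed w.r.t. reference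
Orientation : Graph → Set
Orientation G = E G → Bool

tail head : (G : Graph) → Orientation G → E G → Fin (n G)
tail G o e = if o e then proj₂ (lookup (edges G) e) else proj₁ (lookup (edges G) e)
head G o e = if o e then proj₁ (lookup (edges G) e) else proj₂ (lookup (edges G) e)

open import Data.Fin using (_≟_)
open import Relation.Nullary.Decidable using (⌊_⌋)

sumE : (G : Graph) → (E G → ℤ) → ℤ
sumE G f = foldr _+_ (+ 0) (map f (allFin (length (edges G))))

inflow outflow : (G : Graph) → Orientation G → (E G → ℤ) → Fin (n G) → ℤ
inflow  G o ψ v = sumE G (λ e → if ⌊ head G o e ≟ v ⌋ then ψ e else + 0)
outflow G o ψ v = sumE G (λ e → if ⌊ tail G o e ≟ v ⌋ then ψ e else + 0)

record IsFlow (k : ℕ) (G : Graph) (o : Orientation G) (ψ : E G → ℤ) : Set where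
  field
    conservation : ∀ v → inflow G o ψ v ≡ outflow G o ψ v
    bounded      : ∀ e → ∣ ψ e ∣ ≤ℕ pred k

record IsNZF (k : ℕ) (G : Graph) (o : Orientation G) (ψ : E G → ℤ) : Set where
  field
    flow    : IsFlow k G o ψ
    nonzero : ∀ e → ¬ (ψ e ≡ + 0)

data HasNZF (k : ℕ) (G : Graph) : Set where
  hasNZF : (o : Orientation G) (ψ : E G → ℤ) → IsNZF k G o ψ → HasNZF k G

removeEdges : (G : Graph) → Subset (length (edges G)) → Graph
removeEdges G R = graph (n G) (keep (edges G) R)
  where
  keep : ∀ {A : Set} (xs : List A) → Subset (length xs) → List A
  keep []       _              = []
  keep (x ∷ xs) (true  V.∷ R)  = keep xs R
  keep (x ∷ xs) (false V.∷ R)  = x ∷ keep xs R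

Removable : ℕ → (G : Graph) → Subset (length (edges G)) → Set
Removable k G R = HasNZF k (removeEdges G R)

module Submission where

-- Read a nowhere-zero 4-flow along the reference orientation as an integer circulation φ with
-- values in {±1, ±2, ±3}. Every integer circulation is congruent mod 2 to a circulation with
-- values in {-1, 0, 1}: orient the edges where it is odd so that in- and out-degree differ by
-- at most one at every vertex; the boundary of the resulting ±1-signing is then both even and
-- of absolute value at most 1, hence zero. Applied twice this gives φ ≡ χ₁ + 2χ₂ (mod 4), and
-- once more χ₃ ≡ χ₁ + χ₂ (mod 2). As φ ≢ 0 (mod 4), every edge lies in exactly two of the
-- supports of χ₁, χ₂, χ₃. For each pair, χᵢ + χⱼ and χᵢ − χⱼ are 3-flows whose zero sets are
-- disjoint subsets of supp χᵢ ∩ supp χⱼ, so one of them vanishes on at most half of it, and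
-- deleting its zeros leaves a nowhere-zero 3-flow. The three intersections are disjoint, so
-- the best of the six choices deletes at most |E(G)|/6 edges.

module IntegerParity where

  open import Data.Nat as ℕ using (zero; suc; parity; ⌊_/2⌋)
  import Data.Nat.Properties as ℕ
  open import Data.Integer using (ℤ; +_; -[1+_]; _+_; -_; _⊖_; ∣_∣)
  open import Data.Integer.Properties using ([1+m]⊖[1+n]≡m⊖n; ∣-i∣≡∣i∣; neg-distrib-+)
  open import Data.Parity as ℙ using (Parity; 0ℙ)
  import Data.Parity.Properties as ℙ
  open import Data.Product using (∃; _,_)
  open import Function using (_∘_)
  open import Relation.Binary.PropositionalEquality
  open ≡-Reasoning

  parityℤ : ℤ → Parity
  parityℤ i = parity ∣ i ∣

  private
    parity-suc+suc : ∀ m n → parity (suc m) ℙ.+ parity (suc n) ≡ parity m ℙ.+ parity n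
    parity-suc+suc m n = begin
      parity (suc m) ℙ.+ parity (suc n) ≡⟨ ℙ.+-homo-+ (suc m) (suc n) ⟨
      parity (suc m ℕ.+ suc n)          ≡⟨ cong (parity ∘ suc) (ℕ.+-suc m n) ⟩
      parity (m ℕ.+ n)                  ≡⟨ ℙ.+-homo-+ m n ⟩
      parity m ℙ.+ parity n             ∎

    parity-∣⊖∣ : ∀ m n → parity ∣ m ⊖ n ∣ ≡ parity m ℙ.+ parity n
    parity-∣⊖∣ m       zero    = sym (ℙ.+-identityʳ (parity m))
    parity-∣⊖∣ zero    (suc n) = refl
    parity-∣⊖∣ (suc m) (suc n) = begin
      parity ∣ suc m ⊖ suc n ∣          ≡⟨ cong (parity ∘ ∣_∣) ([1+m]⊖[1+n]≡m⊖n m n) ⟩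
      parity ∣ m ⊖ n ∣                  ≡⟨ parity-∣⊖∣ m n ⟩
      parity m ℙ.+ parity n             ≡⟨ parity-suc+suc m n ⟨
      parity (suc m) ℙ.+ parity (suc n) ∎

    even⇒half+half : ∀ n → parity n ≡ 0ℙ → n ≡ ⌊ n /2⌋ ℕ.+ ⌊ n /2⌋
    even⇒half+half zero          _    = refl
    even⇒half+half (suc (suc n)) even = cong suc (begin
      suc n                     ≡⟨ cong suc (even⇒half+half n even) ⟩
      suc (⌊ n /2⌋ ℕ.+ ⌊ n /2⌋) ≡⟨ ℕ.+-suc ⌊ n /2⌋ ⌊ n /2⌋ ⟨
      ⌊ n /2⌋ ℕ.+ suc ⌊ n /2⌋   ∎)

  parityℤ-+ : ∀ i j → parityℤ (i + j) ≡ parityℤ i ℙ.+ parityℤ j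
  parityℤ-+ (+ m)    (+ n)    = ℙ.+-homo-+ m n
  parityℤ-+ (+ m)    -[1+ n ] = parity-∣⊖∣ m (suc n)
  parityℤ-+ -[1+ m ] (+ n)    = trans (parity-∣⊖∣ n (suc m)) (ℙ.+-comm (parity n) _)
  parityℤ-+ -[1+ m ] -[1+ n ] = trans (ℙ.+-homo-+ m n) (sym (parity-suc+suc m n))

  parityℤ-neg : ∀ i → parityℤ (- i) ≡ parityℤ i
  parityℤ-neg i = cong parity (∣-i∣≡∣i∣ i)

  parityℤ-+-double : ∀ i k → parityℤ (i + (k + k)) ≡ parityℤ i
  parityℤ-+-double i k = begin
    parityℤ (i + (k + k))                    ≡⟨ parityℤ-+ i (k + k) ⟩
    parityℤ i ℙ.+ parityℤ (k + k)            ≡⟨ cong (parityℤ i ℙ.+_) (parityℤ-+ k k) ⟩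
    parityℤ i ℙ.+ (parityℤ k ℙ.+ parityℤ k) ≡⟨ cong (parityℤ i ℙ.+_) (ℙ.p+p≡0ℙ (parityℤ k)) ⟩
    parityℤ i ℙ.+ 0ℙ                         ≡⟨ ℙ.+-identityʳ (parityℤ i) ⟩
    parityℤ i                                ∎

  even⇒double : ∀ i → parityℤ i ≡ 0ℙ → ∃ λ k → i ≡ k + k
  even⇒double (+ n)    even = + ⌊ n /2⌋ , cong +_ (even⇒half+half n even)
  even⇒double -[1+ n ] even = - + h , (begin
    - + suc n         ≡⟨ cong (-_ ∘ +_) (even⇒half+half (suc n) even) ⟩
    - (+ h + + h)     ≡⟨ neg-distrib-+ (+ h) (+ h) ⟩
    - + h + - + h     ∎)
    where h = ⌊ suc n /2⌋

module Trits where

  open import Data.Nat as ℕ using (zero; suc; s≤s; z≤n)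
  import Data.Nat.Properties as ℕ
  open import Data.Integer using (ℤ; +_; -[1+_]; +[1+_]; 0ℤ; 1ℤ; -1ℤ; _+_; _-_; -_; ∣_∣)
  open import Data.Integer.Properties using (∣i+j∣≤∣i∣+∣j∣; ∣i∣≡0⇒i≡0; abs-*; +-identityˡ)
  open import Data.Integer.Solver using (module +-*-Solver)
  open import Data.Parity as ℙ using (0ℙ; 1ℙ)
  import Data.Parity.Properties as ℙ
  open import Data.Product using (∃; _×_; _,_)
  open import Data.Sum using (_⊎_; inj₁; inj₂)
  open import Data.Empty using (⊥-elim)
  open import Relation.Binary.PropositionalEquality
  open +-*-Solver
  open IntegerParity

  data Trit : ℤ → Set where
    0ᵗ  : Trit 0ℤ
    +1ᵗ : Trit 1ℤ
    -1ᵗ : Trit -1ℤ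

  trit-neg : ∀ {c} → Trit c → Trit (- c)
  trit-neg 0ᵗ  = 0ᵗ
  trit-neg +1ᵗ = -1ᵗ
  trit-neg -1ᵗ = +1ᵗ

  ∣trit∣≤1 : ∀ {c} → Trit c → ∣ c ∣ ℕ.≤ 1
  ∣trit∣≤1 0ᵗ  = z≤n
  ∣trit∣≤1 +1ᵗ = s≤s z≤n
  ∣trit∣≤1 -1ᵗ = s≤s z≤n

  ∣trit+trit∣≤2 : ∀ {a b} → Trit a → Trit b → ∣ a + b ∣ ℕ.≤ 2
  ∣trit+trit∣≤2 {a} {b} ta tb =
    ℕ.≤-trans (∣i+j∣≤∣i∣+∣j∣ a b) (ℕ.+-mono-≤ (∣trit∣≤1 ta) (∣trit∣≤1 tb))

  even-trit≡0 : ∀ {c} → Trit c → parityℤ c ≡ 0ℙ → c ≡ 0ℤ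
  even-trit≡0 0ᵗ  _  = refl
  even-trit≡0 +1ᵗ ()
  even-trit≡0 -1ᵗ ()

  double≡0⇒≡0 : ∀ k → k + k ≡ 0ℤ → k ≡ 0ℤ
  double≡0⇒≡0 (+ zero) _  = refl
  double≡0⇒≡0 +[1+ _ ] ()
  double≡0⇒≡0 -[1+ _ ] ()

  ∣quadruple∣≤3⇒≡0 : ∀ h → ∣ (h + h) + (h + h) ∣ ℕ.≤ 3 → h ≡ 0ℤ
  ∣quadruple∣≤3⇒≡0 h ∣4h∣≤3 =
    ∣i∣≡0⇒i≡0 (n*4≤3⇒n≡0 ∣ h ∣ (subst (ℕ._≤ 3) ∣4h∣≡∣h∣*4 ∣4h∣≤3))
    where
    ∣4h∣≡∣h∣*4 : ∣ (h + h) + (h + h) ∣ ≡ ∣ h ∣ ℕ.* 4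
    ∣4h∣≡∣h∣*4 = trans (cong ∣_∣ (solve 1 (λ x → (x :+ x) :+ (x :+ x) := x :* con (+ 4)) refl h))
                       (abs-* h (+ 4))
    n*4≤3⇒n≡0 : ∀ n → n ℕ.* 4 ℕ.≤ 3 → n ≡ 0
    n*4≤3⇒n≡0 zero    _ = refl
    n*4≤3⇒n≡0 (suc n) (s≤s (s≤s (s≤s ())))

  Residue₂ : ℤ → ℤ → Set
  Residue₂ y c = Trit c × parityℤ c ≡ parityℤ y

  residue-decomposition : ∀ {y c} → Residue₂ y c → ∃ λ k → y ≡ c + (k + k)
  residue-decomposition {y} {c} (_ , c∼y) =
    let k , y-c≡k+k = even⇒double (y - c) y-c-even
    in  k , trans (solve 2 (λ y c → y := c :+ (y :- c)) refl y c) (cong (_+_ c) y-c≡k+k)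
    where
    open ≡-Reasoning
    y-c-even : parityℤ (y - c) ≡ 0ℙ
    y-c-even = begin
      parityℤ (y - c)             ≡⟨ parityℤ-+ y (- c) ⟩
      parityℤ y ℙ.+ parityℤ (- c) ≡⟨ cong (parityℤ y ℙ.+_) (trans (parityℤ-neg c) c∼y) ⟩
      parityℤ y ℙ.+ parityℤ y     ≡⟨ ℙ.p+p≡0ℙ (parityℤ y) ⟩
      0ℙ                          ∎

  private
    odd-or-even : ∀ p → p ≡ 1ℙ ⊎ p ≡ 0ℙ
    odd-or-even 1ℙ = inj₁ refl
    odd-or-even 0ℙ = inj₂ refl

  even-digits⇒quadruple : ∀ {y c₁ g c₂} → Residue₂ y c₁ → y ≡ c₁ + (g + g) → Residue₂ g c₂ →
                          parityℤ c₁ ≡ 0ℙ → parityℤ c₂ ≡ 0ℙ → ∃ λ h → y ≡ (h + h) + (h + h)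
  even-digits⇒quadruple {g = g} (t₁ , _) y≡c₁+2g (_ , c₂∼g) even₁ even₂
    with even-trit≡0 t₁ even₁ | even⇒double g (trans (sym c₂∼g) even₂)
  ... | refl | h , refl = h , trans y≡c₁+2g (+-identityˡ _)

  nonzero-mod-4⇒odd-digit : ∀ {y c₁ g c₂} → y ≢ 0ℤ → ∣ y ∣ ℕ.≤ 3 →
                            Residue₂ y c₁ → y ≡ c₁ + (g + g) → Residue₂ g c₂ →
                            parityℤ c₁ ≡ 1ℙ ⊎ parityℤ c₂ ≡ 1ℙ
  nonzero-mod-4⇒odd-digit {c₁ = c₁} {g} {c₂} y≢0 ∣y∣≤3 r₁ y≡c₁+2g r₂
    with odd-or-even (parityℤ c₁) | odd-or-even (parityℤ c₂)
  ... | inj₁ odd₁  | _          = inj₁ odd₁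
  ... | inj₂ _     | inj₁ odd₂  = inj₂ odd₂
  ... | inj₂ even₁ | inj₂ even₂ with even-digits⇒quadruple {g = g} r₁ y≡c₁+2g r₂ even₁ even₂
  ...   | h , refl = ⊥-elim (y≢0 (cong (λ h → (h + h) + (h + h)) (∣quadruple∣≤3⇒≡0 h ∣y∣≤3)))

module Sums where

  open import Data.Nat as ℕ using (ℕ; zero; suc; z≤n)
  import Data.Nat.Properties as ℕ
  open import Data.Integer as ℤ using (ℤ; -_)
  import Data.Integer.Properties as ℤ
  open import Data.Bool using (Bool; true; false; if_then_else_)
  open import Data.Fin using (Fin; zero; suc)
  open import Data.Fin.Subset using (∣_∣)
  import Data.Vec as Vec
  open import Function using (_∘_)
  open import Relation.Binary.PropositionalEquality
  import Algebra.Properties.Semiring.Sum as SemiringSum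

  module ℤΣ = SemiringSum ℤ.+-*-semiring
  module ℕΣ = SemiringSum ℕ.+-*-semiring

  private variable m : ℕ

  sum-neg : (f : Fin m → ℤ) → ℤΣ.sum (λ i → - f i) ≡ - ℤΣ.sum f
  sum-neg {zero}  f = refl
  sum-neg {suc m} f =
    trans (cong (ℤ._+_ (- f zero)) (sum-neg (f ∘ suc))) (sym (ℤ.neg-distrib-+ (f zero) _))

  sum-− : (f g : Fin m → ℤ) → ℤΣ.sum (λ i → f i ℤ.- g i) ≡ ℤΣ.sum f ℤ.- ℤΣ.sum g
  sum-− f g = trans (ℤΣ.∑-distrib-+ f (λ i → - g i)) (cong (ℤ._+_ (ℤΣ.sum f)) (sum-neg g))

  sum-mono-≤ : {f g : Fin m → ℕ} → (∀ i → f i ℕ.≤ g i) → ℕΣ.sum f ℕ.≤ ℕΣ.sum g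
  sum-mono-≤ {zero}  _   = z≤n
  sum-mono-≤ {suc m} f≤g = ℕ.+-mono-≤ (f≤g zero) (sum-mono-≤ (f≤g ∘ suc))

  sum-≤-* : ∀ {c} {f : Fin m → ℕ} → (∀ i → f i ℕ.≤ c) → ℕΣ.sum f ℕ.≤ m ℕ.* c
  sum-≤-* {zero}  _   = z≤n
  sum-≤-* {suc m} f≤c = ℕ.+-mono-≤ (f≤c zero) (sum-≤-* (f≤c ∘ suc))

  ∣tabulate∣ : (p : Fin m → Bool) → ∣ Vec.tabulate p ∣ ≡ ℕΣ.sum λ i → if p i then 1 else 0
  ∣tabulate∣ {zero}  p = refl
  ∣tabulate∣ {suc m} p with p zero
  ... | true  = cong suc (∣tabulate∣ (p ∘ suc))
  ... | false = ∣tabulate∣ (p ∘ suc)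

module Selection where

  open import Data.Nat using (ℕ; z≤n; _+_; _*_; _≤_)
  open import Data.Nat.Properties using (+-mono-≤; *-monoʳ-≤; *-assoc; module ≤-Reasoning)
  open import Data.Nat.Solver using (module +-*-Solver)
  open import Data.Nat.ListAction using (sum)
  open import Data.Fin.Subset using (Subset; ∣_∣)
  open import Data.List using ([]; _∷_; length; map)
  open import Data.List.Extrema.Nat using (argmin; f[argmin]≤f[⊤]; f[argmin]≤f[xs])
  open import Data.List.Relation.Unary.All using (All; []; _∷_)
  open import Data.Product using (Σ; _,_; proj₁)
  open import Function using (_∘_)
  open import Relation.Binary.PropositionalEquality using (_≡_; refl)

  size : ∀ {m} {P : Subset m → Set} → Σ (Subset m) P → ℕ
  size = ∣_∣ ∘ proj₁

  below-average : ∀ {A : Set} (f : A → ℕ) x xs →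
                  length (x ∷ xs) * f (argmin f x xs) ≤ sum (map f (x ∷ xs))
  below-average f x xs = all-above (f[argmin]≤f[⊤] {f = f} x xs ∷ f[argmin]≤f[xs] {f = f} x xs)
    where
    all-above : ∀ {c ys} → All (λ y → c ≤ f y) ys → length ys * c ≤ sum (map f ys)
    all-above []              = z≤n
    all-above (c≤fy ∷ c≤fys) = +-mono-≤ c≤fy (all-above c≤fys)

  smallest-of-three : ∀ {m} {P : Subset m → Set} {A B C N} (R₁ R₂ R₃ : Σ (Subset m) P) →
                      2 * size R₁ ≤ A → 2 * size R₂ ≤ B → 2 * size R₃ ≤ C → A + B + C ≤ N →
                      Σ (Σ (Subset m) P) λ R → 6 * size R ≤ N
  smallest-of-three {A = A} {B} {C} {N} R₁ R₂ R₃ 2∣R₁∣≤A 2∣R₂∣≤B 2∣R₃∣≤C A+B+C≤N = best , (begin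
    6 * size best                             ≡⟨ *-assoc 2 3 (size best) ⟩
    2 * (3 * size best)                       ≤⟨ *-monoʳ-≤ 2 (below-average size R₁ (R₂ ∷ R₃ ∷ [])) ⟩
    2 * (size R₁ + (size R₂ + (size R₃ + 0))) ≡⟨ distribute (size R₁) (size R₂) (size R₃) ⟩
    2 * size R₁ + 2 * size R₂ + 2 * size R₃   ≤⟨ +-mono-≤ (+-mono-≤ 2∣R₁∣≤A 2∣R₂∣≤B) 2∣R₃∣≤C ⟩
    A + B + C                                 ≤⟨ A+B+C≤N ⟩
    N                                         ∎)
    where
    open ≤-Reasoning
    open +-*-Solver
    best = argmin size R₁ (R₂ ∷ R₃ ∷ [])
    distribute : ∀ a b c → 2 * (a + (b + (c + 0))) ≡ 2 * a + 2 * b + 2 * c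
    distribute = solve 3 (λ a b c → con 2 :* (a :+ (b :+ (c :+ con 0))) := con 2 :* a :+ con 2 :* b :+ con 2 :* c)
                         refl

module Circulations where

  open import Data.Nat as ℕ using (ℕ; zero; suc; pred)
  open import Data.Integer using (ℤ; 0ℤ; 1ℤ; _+_; _-_; -_; _*_; ∣_∣)
  open import Data.Integer.Properties using
    ( *-distribʳ-+; neg-distribˡ-*; *-identityʳ; *-zeroʳ; +-inverseʳ
    ; i≡j⇒i-j≡0; i-j≡0⇒i≡j; neg-injective; ∣-i∣≡∣i∣
    )
  open import Data.Integer.Solver using (module +-*-Solver)
  open import Data.Bool using (Bool; true; false; if_then_else_)
  open import Data.Fin using (Fin; zero; suc; _≟_)
  open import Data.List as List using (List; length; lookup; tabulate)
  open import Data.List.Properties using (map-tabulate)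
  open import Data.Product using (_×_; _,_)
  open import Function using (_∘_)
  open import Relation.Nullary.Decidable using (⌊_⌋)
  open import Relation.Binary.PropositionalEquality
  open import Defs hiding (n)
  open Trits using (Trit; 0ᵗ; +1ᵗ; -1ᵗ)
  open Sums

  private variable n : ℕ

  Arc : ℕ → Set
  Arc n = Fin n × Fin n

  δ : Fin n → Fin n → ℤ
  δ x v = if ⌊ x ≟ v ⌋ then 1ℤ else 0ℤ

  incidence : Fin n → Arc n → ℤ
  incidence v (a , b) = δ b v - δ a v

  incidence-trit : ∀ (v : Fin n) x → Trit (incidence v x)
  incidence-trit v (a , b) with ⌊ a ≟ v ⌋ | ⌊ b ≟ v ⌋
  ... | true  | true  = 0ᵗ
  ... | true  | false = -1ᵗ
  ... | false | true  = +1ᵗ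
  ... | false | false = 0ᵗ

  incidence-loop : ∀ (v a : Fin n) → incidence v (a , a) ≡ 0ℤ
  incidence-loop v a = +-inverseʳ (δ a v)

  incidence-reversed : ∀ (v a b : Fin n) → incidence v (b , a) ≡ - incidence v (a , b)
  incidence-reversed v a b = solve 2 (λ A B → A :- B := :- (B :- A)) refl (δ a v) (δ b v)
    where open +-*-Solver

  incidence-path : ∀ (v p w q : Fin n) → incidence v (p , w) + incidence v (w , q) ≡ incidence v (p , q)
  incidence-path v p w q = solve 3 (λ P W Q → (W :- P) :+ (Q :- W) := Q :- P) refl (δ p v) (δ w v) (δ q v)
    where open +-*-Solver

  boundary : (xs : List (Arc n)) → (Fin (length xs) → ℤ) → Fin n → ℤ
  boundary xs φ v = ℤΣ.sum λ e → φ e * incidence v (lookup xs e)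

  IsCirculation : (xs : List (Arc n)) → (Fin (length xs) → ℤ) → Set
  IsCirculation xs φ = ∀ v → boundary xs φ v ≡ 0ℤ

  module _ (xs : List (Arc n)) where

    boundary-cong : ∀ {φ χ} → (∀ e → φ e ≡ χ e) → ∀ v → boundary xs φ v ≡ boundary xs χ v
    boundary-cong φ≗χ v = ℤΣ.sum-cong-≗ λ e → cong (_* incidence v (lookup xs e)) (φ≗χ e)

    boundary-+ : ∀ φ χ v → boundary xs (λ e → φ e + χ e) v ≡ boundary xs φ v + boundary xs χ v
    boundary-+ φ χ v = trans (ℤΣ.sum-cong-≗ λ e → *-distribʳ-+ (I e) (φ e) (χ e))
                             (ℤΣ.∑-distrib-+ (λ e → φ e * I e) (λ e → χ e * I e))
      where I = λ e → incidence v (lookup xs e)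

    boundary-neg : ∀ φ v → boundary xs (λ e → - φ e) v ≡ - boundary xs φ v
    boundary-neg φ v = trans (ℤΣ.sum-cong-≗ λ e → sym (neg-distribˡ-* (φ e) (I e)))
                             (sum-neg λ e → φ e * I e)
      where I = λ e → incidence v (lookup xs e)

    circulation-+ : ∀ {φ χ} → IsCirculation xs φ → IsCirculation xs χ → IsCirculation xs (λ e → φ e + χ e)
    circulation-+ {φ} {χ} φ-circ χ-circ v = trans (boundary-+ φ χ v) (cong₂ _+_ (φ-circ v) (χ-circ v))

    circulation-neg : ∀ {φ} → IsCirculation xs φ → IsCirculation xs (λ e → - φ e)
    circulation-neg {φ} φ-circ v = trans (boundary-neg φ v) (cong -_ (φ-circ v))

    circulation-− : ∀ {φ χ} → IsCirculation xs φ → IsCirculation xs χ → IsCirculation xs (λ e → φ e - χ e)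
    circulation-− {φ} {χ} φ-circ χ-circ = circulation-+ {φ} {λ e → - χ e} φ-circ (circulation-neg {χ} χ-circ)

  alongReference : (G : Graph) → Orientation G → (E G → ℤ) → E G → ℤ
  alongReference G o ψ e = if o e then - ψ e else ψ e

  reference : (G : Graph) → Orientation G
  reference G _ = false

  private
    sumE≡sum : (G : Graph) (f : E G → ℤ) → sumE G f ≡ ℤΣ.sum f
    sumE≡sum G f = trans (cong (List.foldr _+_ 0ℤ) (map-tabulate (λ e → e) f)) (foldr-tabulate f)
      where
      foldr-tabulate : ∀ {m} (f : Fin m → ℤ) → List.foldr _+_ 0ℤ (tabulate f) ≡ ℤΣ.sum f
      foldr-tabulate {zero}  f = refl
      foldr-tabulate {suc m} f = cong (f zero +_) (foldr-tabulate (f ∘ suc))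

    gate : (x v : Fin n) (p : ℤ) → (if ⌊ x ≟ v ⌋ then p else 0ℤ) ≡ p * δ x v
    gate x v p with ⌊ x ≟ v ⌋
    ... | true  = sym (*-identityʳ p)
    ... | false = sym (*-zeroʳ p)

    head-minus-tail : ∀ (b : Bool) (x y v : Fin n) p →
                      p * δ (if b then x else y) v - p * δ (if b then y else x) v
                        ≡ (if b then - p else p) * incidence v (x , y)
    head-minus-tail true  x y v p =
      solve 3 (λ p X Y → p :* X :- p :* Y := (:- p) :* (Y :- X)) refl p (δ x v) (δ y v)
      where open +-*-Solver
    head-minus-tail false x y v p =
      solve 3 (λ p X Y → p :* Y :- p :* X := p :* (Y :- X)) refl p (δ x v) (δ y v)
      where open +-*-Solver

  inflow-outflow≡boundary : ∀ G o ψ v →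
                            inflow G o ψ v - outflow G o ψ v ≡ boundary (edges G) (alongReference G o ψ) v
  inflow-outflow≡boundary G o ψ v = begin
    inflow G o ψ v - outflow G o ψ v            ≡⟨ cong₂ _-_ (sumE≡sum G into) (sumE≡sum G out-of) ⟩
    ℤΣ.sum into - ℤΣ.sum out-of                 ≡⟨ sum-− into out-of ⟨
    ℤΣ.sum (λ e → into e - out-of e)            ≡⟨ ℤΣ.sum-cong-≗ edge-term ⟩
    boundary (edges G) (alongReference G o ψ) v ∎
    where
    open ≡-Reasoning
    into out-of : E G → ℤ
    into   e = if ⌊ head G o e ≟ v ⌋ then ψ e else 0ℤ
    out-of e = if ⌊ tail G o e ≟ v ⌋ then ψ e else 0ℤ
    edge-term : ∀ e → into e - out-of e ≡ alongReference G o ψ e * incidence v (lookup (edges G) e)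
    edge-term e = let a , b = lookup (edges G) e in
      trans (cong₂ _-_ (gate (head G o e) v (ψ e)) (gate (tail G o e) v (ψ e))) (head-minus-tail (o e) a b v (ψ e))

  conservation⇒circulation : ∀ G o ψ → (∀ v → inflow G o ψ v ≡ outflow G o ψ v) →
                             IsCirculation (edges G) (alongReference G o ψ)
  conservation⇒circulation G o ψ conserved v =
    trans (sym (inflow-outflow≡boundary G o ψ v)) (i≡j⇒i-j≡0 (conserved v))

  circulation⇒conservation : ∀ G φ → IsCirculation (edges G) φ →
                             ∀ v → inflow G (reference G) φ v ≡ outflow G (reference G) φ v
  circulation⇒conservation G φ circ v =
    i-j≡0⇒i≡j _ _ (trans (inflow-outflow≡boundary G (reference G) φ v) (circ v))

  nzf-along-reference : ∀ {k G o ψ} → IsNZF k G o ψ →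
                        IsCirculation (edges G) (alongReference G o ψ) ×
                        (∀ e → alongReference G o ψ e ≢ 0ℤ) × (∀ e → ∣ alongReference G o ψ e ∣ ℕ.≤ pred k)
  nzf-along-reference {k} {G} {o} {ψ} nzf = conservation⇒circulation G o ψ conservation , nonzero′ , bounded′
    where
    open IsNZF nzf
    open IsFlow flow
    nonzero′ : ∀ e → alongReference G o ψ e ≢ 0ℤ
    nonzero′ e with o e
    ... | true  = nonzero e ∘ neg-injective
    ... | false = nonzero e
    bounded′ : ∀ e → ∣ alongReference G o ψ e ∣ ℕ.≤ pred k
    bounded′ e with o e
    ... | true  = subst (ℕ._≤ pred k) (sym (∣-i∣≡∣i∣ (ψ e))) (bounded e)
    ... | false = bounded e

module Removal where

  open import Data.Nat as ℕ using (ℕ; zero; suc; pred)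
  open import Data.Integer using (ℤ; +_; +[1+_]; -[1+_]; 0ℤ; _+_; _*_; ∣_∣)
  open import Data.Integer.Properties using (+-identityˡ)
  open import Data.Bool using (Bool; true; false)
  open import Data.Fin using (Fin; zero; suc)
  open import Data.Fin.Subset using (Subset; _∈_; _∉_)
  open import Data.Fin.Subset.Properties using (drop-there)
  open import Data.List using (List; []; _∷_; length)
  open import Data.Vec as Vec using ([]; _∷_; here; there)
  open import Data.Vec.Properties using ([]=⇒lookup; lookup⇒[]=; lookup∘tabulate)
  open import Data.Product using (∃; _×_; _,_)
  open import Function using (_∘_)
  open import Relation.Binary.PropositionalEquality
  open import Defs hiding (n)
  open Circulations

  private variable
    n : ℕ
    A : Set

  kept : (xs : List (Arc n)) → Subset (length xs) → List (Arc n)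
  kept {n} xs R = edges (removeEdges (graph n xs) R)

  restrict : (xs : List (Arc n)) (R : Subset (length xs)) → (Fin (length xs) → A) → Fin (length (kept xs R)) → A
  restrict (x ∷ xs) (true  ∷ R) f i       = restrict xs R (f ∘ suc) i
  restrict (x ∷ xs) (false ∷ R) f zero    = f zero
  restrict (x ∷ xs) (false ∷ R) f (suc i) = restrict xs R (f ∘ suc) i

  boundary-restrict : (xs : List (Arc n)) (R : Subset (length xs)) (φ : Fin (length xs) → ℤ) →
                      (∀ e → e ∈ R → φ e ≡ 0ℤ) →
                      ∀ v → boundary (kept xs R) (restrict xs R φ) v ≡ boundary xs φ v
  boundary-restrict []       []          φ _      v = refl
  boundary-restrict (x ∷ xs) (true  ∷ R) φ φ[R]≡0 v = begin
    boundary (kept xs R) (restrict xs R (φ ∘ suc)) v ≡⟨ boundary-restrict xs R (φ ∘ suc) φ[R]≡0′ v ⟩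
    ∂                                                ≡⟨ +-identityˡ ∂ ⟨
    0ℤ * incidence v x + ∂                           ≡⟨ cong (λ c → c * incidence v x + ∂) (φ[R]≡0 zero here) ⟨
    φ zero * incidence v x + ∂                       ∎
    where
    open ≡-Reasoning
    ∂ = boundary xs (φ ∘ suc) v
    φ[R]≡0′ = λ e → φ[R]≡0 (suc e) ∘ there
  boundary-restrict (x ∷ xs) (false ∷ R) φ φ[R]≡0 v =
    cong (_+_ (φ zero * incidence v x)) (boundary-restrict xs R (φ ∘ suc) (λ e → φ[R]≡0 (suc e) ∘ there) v)

  restrict-outside : (xs : List (Arc n)) (R : Subset (length xs)) (f : Fin (length xs) → A) →
                     ∀ i → ∃ λ e → e ∉ R × restrict xs R f i ≡ f e
  restrict-outside (x ∷ xs) (true ∷ R) f i with restrict-outside xs R (f ∘ suc) i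
  ... | e , e∉R , eq = suc e , e∉R ∘ drop-there , eq
  restrict-outside (x ∷ xs) (false ∷ R) f zero    = zero , (λ ()) , refl
  restrict-outside (x ∷ xs) (false ∷ R) f (suc i) with restrict-outside xs R (f ∘ suc) i
  ... | e , e∉R , eq = suc e , e∉R ∘ drop-there , eq

  isZero : ℤ → Bool
  isZero (+ zero) = true
  isZero _        = false

  isZero-sound : ∀ z → isZero z ≡ true → z ≡ 0ℤ
  isZero-sound (+ zero) _  = refl
  isZero-sound +[1+ _ ] ()
  isZero-sound -[1+ _ ] ()

  zeros : ∀ {m} → (Fin m → ℤ) → Subset m
  zeros φ = Vec.tabulate (isZero ∘ φ)

  ∈-zeros : ∀ {m} {φ : Fin m → ℤ} {e} → e ∈ zeros φ → φ e ≡ 0ℤ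
  ∈-zeros {φ = φ} {e} e∈zeros =
    isZero-sound (φ e) (trans (sym (lookup∘tabulate (isZero ∘ φ) e)) ([]=⇒lookup e∈zeros))

  ∉-zeros : ∀ {m} {φ : Fin m → ℤ} {e} → e ∉ zeros φ → φ e ≢ 0ℤ
  ∉-zeros {φ = φ} {e} e∉zeros φe≡0 =
    e∉zeros (lookup⇒[]= e (zeros φ) (trans (lookup∘tabulate (isZero ∘ φ) e) (cong isZero φe≡0)))

  zeros-removable : ∀ k (G : Graph) (φ : E G → ℤ) →
                    IsCirculation (edges G) φ → (∀ e → ∣ φ e ∣ ℕ.≤ pred k) → Removable k G (zeros φ)
  zeros-removable k G φ circ bounded = hasNZF (reference G−R) φ′ record
    { flow    = record
      { conservation = circulation⇒conservation G−R φ′ λ v →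
          trans (boundary-restrict (edges G) (zeros φ) φ (λ _ → ∈-zeros) v) (circ v)
      ; bounded      = λ i → let e , _ , φ′i≡φe = restrict-outside (edges G) (zeros φ) φ i
                             in  subst (λ z → ∣ z ∣ ℕ.≤ pred k) (sym φ′i≡φe) (bounded e)
      }
    ; nonzero = λ i → let e , e∉zeros , φ′i≡φe = restrict-outside (edges G) (zeros φ) φ i
                      in  ∉-zeros e∉zeros ∘ trans (sym φ′i≡φe)
    }
    where
    G−R = removeEdges G (zeros φ)
    φ′  = restrict (edges G) (zeros φ) φ

module BalancedOrientation where

  open import Data.Nat as ℕ using (ℕ; suc; s≤s)
  open import Data.Nat.Properties using (≤-refl)
  open import Data.Integer using (ℤ; 0ℤ; _+_)
  open import Data.Integer.Properties using (+-identityˡ; +-identityʳ; +-comm; +-assoc)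
  open import Data.Integer.Solver using (module +-*-Solver)
  open import Data.Empty using (⊥-elim)
  open import Data.Fin using (Fin; _≟_)
  open import Data.List using (List; []; _∷_; _++_; length)
  open import Data.List.Properties using (length-++-sucʳ)
  open import Data.List.Relation.Binary.Pointwise using (Pointwise; []; _∷_; ++⁺; All-resp-Pointwise)
  open import Data.List.Relation.Unary.All as All using (All)
  open import Data.List.Relation.Unary.All.Properties using (¬Any⇒All¬)
  open import Data.List.Relation.Unary.Any using (any?)
  open import Data.List.Membership.Propositional using (find)
  open import Data.List.Membership.Propositional.Properties using (∈-∃++)
  open import Data.Product using (∃; ∃₂; _×_; _,_)
  open import Data.Sum using (_⊎_; inj₁; inj₂; swap)
  open import Function using (_∘_)
  open import Relation.Nullary using (¬_; Dec; yes; no)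
  open import Relation.Nullary.Decidable using (_⊎-dec_)
  open import Relation.Binary.PropositionalEquality
  open Trits using (Trit; 0ᵗ)
  open Circulations using (Arc; incidence; incidence-trit; incidence-path)

  private variable
    n : ℕ
    a b v : Fin n
    x y e₀ e₁ : Arc n
    xs ys zs : List (Arc n)

  data Reorientation : Arc n → Arc n → Set where
    as-is    : Reorientation x x
    reversed : Reorientation (a , b) (b , a)

  reverse-after : Reorientation x (a , b) → Reorientation x (b , a)
  reverse-after as-is    = reversed
  reverse-after reversed = as-is

  net : List (Arc n) → Fin n → ℤ
  net []       v = 0ℤ
  net (x ∷ xs) v = incidence v x + net xs v

  Balanced : List (Arc n) → Set
  Balanced xs = ∀ v → Trit (net xs v)

  Incident : Fin n → Arc n → Set
  Incident v (a , b) = a ≡ v ⊎ b ≡ v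

  Touches : Arc n → Arc n → Set
  Touches (a , b) y = Incident a y ⊎ Incident b y

  incident? : ∀ (v : Fin n) x → Dec (Incident v x)
  incident? v (a , b) = (a ≟ v) ⊎-dec (b ≟ v)

  touches? : ∀ (x y : Arc n) → Dec (Touches x y)
  touches? (a , b) y = incident? a y ⊎-dec incident? b y

  incidence-away : ¬ Incident v x → incidence v x ≡ 0ℤ
  incidence-away {v = v} {x = a , b} v∉x with a ≟ v | b ≟ v
  ... | yes a≡v | _       = ⊥-elim (v∉x (inj₁ a≡v))
  ... | no _    | yes b≡v = ⊥-elim (v∉x (inj₂ b≡v))
  ... | no _    | no _    = refl

  net-++ : ∀ (xs ys : List (Arc n)) v → net (xs ++ ys) v ≡ net xs v + net ys v
  net-++ []       ys v = sym (+-identityˡ (net ys v))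
  net-++ (x ∷ xs) ys v = trans (cong (incidence v x +_) (net-++ xs ys v)) (sym (+-assoc (incidence v x) _ _))

  net-away : All (¬_ ∘ Incident v) xs → net xs v ≡ 0ℤ
  net-away All.[]            = refl
  net-away (v∉x All.∷ v∉xs) = cong₂ _+_ (incidence-away v∉x) (net-away v∉xs)

  net-contract : ∀ (xs ys : List (Arc n)) {x₀ x₁ x} v → incidence v x₀ + incidence v x₁ ≡ incidence v x →
                 net (x₀ ∷ xs ++ x₁ ∷ ys) v ≡ net (x ∷ xs ++ ys) v
  net-contract xs ys {x₀} {x₁} {x} v contracts = begin
    incidence v x₀ + net (xs ++ x₁ ∷ ys) v
      ≡⟨ cong (incidence v x₀ +_) (net-++ xs (x₁ ∷ ys) v) ⟩
    incidence v x₀ + (net xs v + (incidence v x₁ + net ys v))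
      ≡⟨ solve 4 (λ a s b t → a :+ (s :+ (b :+ t)) := (a :+ b) :+ (s :+ t)) refl
               (incidence v x₀) (net xs v) (incidence v x₁) (net ys v) ⟩
    (incidence v x₀ + incidence v x₁) + (net xs v + net ys v)
      ≡⟨ cong₂ _+_ contracts (sym (net-++ xs ys v)) ⟩
    incidence v x + net (xs ++ ys) v
      ∎
    where
    open ≡-Reasoning
    open +-*-Solver

  Pointwise-++-split : ∀ {A B : Set} {R : A → B → Set} (xs : List A) {ys zs} →
                       Pointwise R (xs ++ ys) zs →
                       ∃₂ λ xs′ ys′ → zs ≡ xs′ ++ ys′ × Pointwise R xs xs′ × Pointwise R ys ys′
  Pointwise-++-split []       rs       = [] , _ , refl , [] , rs
  Pointwise-++-split (x ∷ xs) (r ∷ rs) with Pointwise-++-split xs rs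
  ... | xs′ , ys′ , refl , rxs , rys = _ ∷ xs′ , ys′ , refl , r ∷ rxs , rys

  record Consecutive (x y : Arc n) : Set where
    constructor path
    field
      {start middle end} : Fin n
      first  : Reorientation x (start , middle)
      second : Reorientation y (middle , end)

  touches⇒consecutive : Touches x y → Consecutive x y
  touches⇒consecutive (inj₁ (inj₁ refl)) = path reversed as-is
  touches⇒consecutive (inj₁ (inj₂ refl)) = path reversed reversed
  touches⇒consecutive (inj₂ (inj₁ refl)) = path as-is as-is
  touches⇒consecutive (inj₂ (inj₂ refl)) = path as-is reversed

  subdivide : ∀ xs {ys zs} (c : Consecutive e₀ e₁) → let open Consecutive c in
              Pointwise Reorientation ((start , end) ∷ xs ++ ys) zs → Balanced zs →
              ∃ λ zs′ → Pointwise Reorientation (e₀ ∷ xs ++ e₁ ∷ ys) zs′ × Balanced zs′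
  subdivide xs (path {p} {w} {q} r₀ r₁) (r ∷ rs) balanced with Pointwise-++-split xs rs
  ... | xs′ , ys′ , refl , rxs , rys with r
  ...   | as-is    =
    (p , w) ∷ xs′ ++ (w , q) ∷ ys′ , r₀ ∷ ++⁺ rxs (r₁ ∷ rys) , λ v →
      subst Trit (sym (net-contract xs′ ys′ {p , w} {w , q} {p , q} v (incidence-path v p w q))) (balanced v)
  ...   | reversed =
    (w , p) ∷ xs′ ++ (q , w) ∷ ys′ , reverse-after r₀ ∷ ++⁺ rxs (reverse-after r₁ ∷ rys) , λ v →
      subst Trit (sym (net-contract xs′ ys′ {w , p} {q , w} {q , p} v (q→w→p v))) (balanced v)
    where
    q→w→p : ∀ v → incidence v (w , p) + incidence v (q , w) ≡ incidence v (q , p)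
    q→w→p v = trans (+-comm (incidence v (w , p)) _) (incidence-path v q w p)

  untouched⇒away : Incident v x → ¬ Touches x y → ¬ Incident v y
  untouched⇒away (inj₁ refl) ¬touch = ¬touch ∘ inj₁
  untouched⇒away (inj₂ refl) ¬touch = ¬touch ∘ inj₂

  reorientation-away : Reorientation x y → ¬ Incident v x → ¬ Incident v y
  reorientation-away as-is    v∉x = v∉x
  reorientation-away reversed v∉x = v∉x ∘ swap

  extend-isolated : All (¬_ ∘ Touches x) ys → Pointwise Reorientation ys zs → Balanced zs → Balanced (x ∷ zs)
  extend-isolated {x = x} {zs = zs} untouched rs balanced v with incident? v x
  ... | yes v∈x = subst Trit (sym (trans (cong (incidence v x +_) (net-away v∉zs)) (+-identityʳ _)))
                             (incidence-trit v x)
    where v∉zs = All-resp-Pointwise reorientation-away rs (All.map (untouched⇒away v∈x) untouched)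
  ... | no v∉x  = subst Trit (sym (trans (cong (_+ net zs v) (incidence-away v∉x)) (+-identityˡ _)))
                             (balanced v)

  -- An arc touching no other one may be oriented either way. Otherwise it is merged with an arc
  -- sharing an endpoint into one arc between their other endpoints; orienting the shorter list
  -- and subdividing that arc again changes no vertex's net degree.
  balanced-orientation : (xs : List (Arc n)) → ∃ λ ys → Pointwise Reorientation xs ys × Balanced ys
  balanced-orientation xs = orient (length xs) xs ≤-refl
    where
    orient : ∀ k (xs : List (Arc n)) → length xs ℕ.≤ k → ∃ λ ys → Pointwise Reorientation xs ys × Balanced ys
    orient _       []       _       = [] , [] , λ _ → 0ᵗ
    orient (suc k) (x ∷ xs) (s≤s ∣xs∣≤k) with any? (touches? x) xs
    ... | no untouched with orient k xs ∣xs∣≤k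
    ...   | ys , rs , balanced = x ∷ ys , as-is ∷ rs , extend-isolated (¬Any⇒All¬ xs untouched) rs balanced
    orient (suc k) (x ∷ xs) (s≤s ∣xs∣≤k) | yes touching with find touching
    ... | y , y∈xs , x∼y with ∈-∃++ y∈xs
    ...   | pre , post , refl with touches⇒consecutive x∼y
    ...     | c with orient k ((Consecutive.start c , Consecutive.end c) ∷ pre ++ post)
                            (subst (ℕ._≤ k) (length-++-sucʳ pre y post) ∣xs∣≤k)
    ...       | zs , rs , balanced = subdivide pre c rs balanced

module ParityLifting where

  open import Data.Nat using (ℕ)
  open import Data.Integer using (ℤ; 0ℤ; 1ℤ; -1ℤ; _+_; _*_)
  open import Data.Integer.Properties using (*-identityˡ; -1*i≡-i; +-identityˡ)
  open import Data.Parity using (Parity; 0ℙ; 1ℙ)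
  open import Data.Fin using (Fin; zero; suc)
  open import Data.List using (List; []; _∷_; length)
  open import Data.List.Relation.Binary.Pointwise using (Pointwise; []; _∷_)
  open import Data.Product using (∃; _×_; _,_; proj₁; proj₂)
  open import Function using (_∘_)
  open import Relation.Binary.PropositionalEquality
  open IntegerParity
  open Trits
  open Circulations
  open BalancedOrientation

  private variable
    n : ℕ
    xs : List (Arc n)

  keepIfOdd : Parity → Arc n → Arc n
  keepIfOdd 0ℙ (a , _) = a , a
  keepIfOdd 1ℙ x       = x

  -- Even edges become loops: whichever way they are oriented, they contribute nothing to a boundary.
  maskEven : (xs : List (Arc n)) → (Fin (length xs) → Parity) → List (Arc n)
  maskEven []       _ = []
  maskEven (x ∷ xs) p = keepIfOdd (p zero) x ∷ maskEven xs (p ∘ suc)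

  signOn : ∀ q {x y : Arc n} → Reorientation (keepIfOdd q x) y → ℤ
  signOn 0ℙ _        = 0ℤ
  signOn 1ℙ as-is    = 1ℤ
  signOn 1ℙ reversed = -1ℤ

  signOn-incidence : ∀ q {x y : Arc n} (r : Reorientation (keepIfOdd q x) y) v →
                     signOn q r * incidence v x ≡ incidence v y
  signOn-incidence 0ℙ {a , _} as-is    v = sym (incidence-loop v a)
  signOn-incidence 0ℙ {a , _} reversed v = sym (incidence-loop v a)
  signOn-incidence 1ℙ         as-is    v = *-identityˡ _
  signOn-incidence 1ℙ {a , b} reversed v = trans (-1*i≡-i _) (sym (incidence-reversed v a b))

  signOn-trit : ∀ q {x y : Arc n} (r : Reorientation (keepIfOdd q x) y) →
                Trit (signOn q r) × parityℤ (signOn q r) ≡ q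
  signOn-trit 0ℙ _        = 0ᵗ , refl
  signOn-trit 1ℙ as-is    = +1ᵗ , refl
  signOn-trit 1ℙ reversed = -1ᵗ , refl

  signs : ∀ (xs : List (Arc n)) p {ys} → Pointwise Reorientation (maskEven xs p) ys → Fin (length xs) → ℤ
  signs (x ∷ xs) p (r ∷ rs) zero    = signOn (p zero) r
  signs (x ∷ xs) p (r ∷ rs) (suc e) = signs xs (p ∘ suc) rs e

  boundary-signs : ∀ (xs : List (Arc n)) p {ys} (rs : Pointwise Reorientation (maskEven xs p) ys) v →
                   boundary xs (signs xs p rs) v ≡ net ys v
  boundary-signs []       p []       v = refl
  boundary-signs (x ∷ xs) p (r ∷ rs) v =
    cong₂ _+_ (signOn-incidence (p zero) r v) (boundary-signs xs (p ∘ suc) rs v)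

  signs-trit : ∀ (xs : List (Arc n)) p {ys} (rs : Pointwise Reorientation (maskEven xs p) ys) e →
               Trit (signs xs p rs e) × parityℤ (signs xs p rs e) ≡ p e
  signs-trit (x ∷ xs) p (r ∷ rs) zero    = signOn-trit (p zero) r
  signs-trit (x ∷ xs) p (r ∷ rs) (suc e) = signs-trit xs (p ∘ suc) rs e

  balanced-signing : ∀ (xs : List (Arc n)) (p : Fin (length xs) → Parity) →
    ∃ λ χ → (∀ e → Trit (χ e) × parityℤ (χ e) ≡ p e) × (∀ v → Trit (boundary xs χ v))
  balanced-signing xs p =
    let ys , rs , balanced = balanced-orientation (maskEven xs p)
    in  signs xs p rs , signs-trit xs p rs , λ v → subst Trit (sym (boundary-signs xs p rs v)) (balanced v)

  boundary-residue : ∀ (xs : List (Arc n)) {φ χ k} → (∀ e → φ e ≡ χ e + (k e + k e)) →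
                     ∀ v → boundary xs φ v ≡ boundary xs χ v + (boundary xs k v + boundary xs k v)
  boundary-residue xs {φ} {χ} {k} φ≡χ+2k v = begin
    boundary xs φ v                                       ≡⟨ boundary-cong xs φ≡χ+2k v ⟩
    boundary xs (λ e → χ e + (k e + k e)) v               ≡⟨ boundary-+ xs χ (λ e → k e + k e) v ⟩
    boundary xs χ v + boundary xs (λ e → k e + k e) v     ≡⟨ cong (boundary xs χ v +_) (boundary-+ xs k k v) ⟩
    boundary xs χ v + (boundary xs k v + boundary xs k v) ∎
    where open ≡-Reasoning

  circulation-half : ∀ (xs : List (Arc n)) {φ χ k} → IsCirculation xs φ → IsCirculation xs χ →
                     (∀ e → φ e ≡ χ e + (k e + k e)) → IsCirculation xs k
  circulation-half xs {φ} {χ} {k} φ-circ χ-circ φ≡χ+2k v = double≡0⇒≡0 (boundary xs k v) (begin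
    boundary xs k v + boundary xs k v                     ≡⟨ +-identityˡ _ ⟨
    0ℤ + (boundary xs k v + boundary xs k v)              ≡⟨ cong (_+ _) (χ-circ v) ⟨
    boundary xs χ v + (boundary xs k v + boundary xs k v) ≡⟨ boundary-residue xs {φ} {χ} {k} φ≡χ+2k v ⟨
    boundary xs φ v                                       ≡⟨ φ-circ v ⟩
    0ℤ                                                    ∎)
    where open ≡-Reasoning

  residue-circulation : ∀ (xs : List (Arc n)) φ → IsCirculation xs φ →
                        ∃ λ χ → IsCirculation xs χ × ∀ e → Residue₂ (φ e) (χ e)
  residue-circulation xs φ φ-circ =
    let χ , residue , balanced = balanced-signing xs (parityℤ ∘ φ)
        k e                    = proj₁ (residue-decomposition {φ e} (residue e))
        φ≡χ+2k e               = proj₂ (residue-decomposition {φ e} (residue e))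
        ∂χ v = boundary xs χ v
        ∂k v = boundary xs k v
    in  χ , (λ v → even-trit≡0 (balanced v) (begin
          parityℤ (∂χ v)                   ≡⟨ parityℤ-+-double (∂χ v) (∂k v) ⟨
          parityℤ (∂χ v + (∂k v + ∂k v))   ≡⟨ cong parityℤ (boundary-residue xs {φ} {χ} {k} φ≡χ+2k v) ⟨
          parityℤ (boundary xs φ v)        ≡⟨ cong parityℤ (φ-circ v) ⟩
          0ℙ                               ∎))
        , residue
    where open ≡-Reasoning

module Covering where

  open import Data.Nat using (ℕ; z≤n; _+_; _*_; _≤_)
  open import Data.Nat.Properties using (≤-refl; *-identityʳ; +-identityʳ; module ≤-Reasoning)
  open import Data.Integer as ℤ using (ℤ; 0ℤ)
  open import Data.Parity as ℙ using (Parity; 0ℙ; 1ℙ)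
  open import Data.Bool using (if_then_else_)
  open import Data.Fin using (Fin)
  open import Data.Fin.Subset using (Subset; ∣_∣)
  open import Data.List using (List; []; _∷_; length)
  open import Data.List.Extrema.Nat using (argmin)
  open import Data.Product using (Σ; _×_; _,_; proj₁; proj₂)
  open import Data.Sum using (_⊎_; inj₁; inj₂)
  open import Function using (_∘_)
  open import Relation.Binary.PropositionalEquality
  open import Defs hiding (n)
  open IntegerParity
  open Trits
  open Sums
  open Circulations
  open Removal
  open ParityLifting
  open Selection

  private variable
    n : ℕ
    xs : List (Arc n)

  record TritCirculation (xs : List (Arc n)) : Set where
    field
      flow        : Fin (length xs) → ℤ
      circulation : IsCirculation xs flow
      trit        : ∀ e → Trit (flow e)

  open TritCirculation

  Covering : (α β : TritCirculation xs) → Set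
  Covering α β = ∀ e → parityℤ (flow α e) ≡ 1ℙ ⊎ parityℤ (flow β e) ≡ 1ℙ

  ⟦_⟧ : Parity → ℕ
  ⟦ 0ℙ ⟧ = 0
  ⟦ 1ℙ ⟧ = 1

  joint-support : (α β : TritCirculation xs) → ℕ
  joint-support α β = ℕΣ.sum λ e → ⟦ parityℤ (flow α e) ℙ.* parityℤ (flow β e) ⟧

  two-digit-decomposition : ∀ {φ} → IsCirculation xs φ → (∀ e → φ e ≢ 0ℤ) → (∀ e → ℤ.∣ φ e ∣ ≤ 3) →
                            Σ (TritCirculation xs) λ χ₁ → Σ (TritCirculation xs) λ χ₂ →
                              Covering χ₁ χ₂
  two-digit-decomposition {xs = xs} {φ} φ-circ φ≢0 ∣φ∣≤3 =
    let χ₁ , χ₁-circ , residue₁ = residue-circulation xs φ φ-circ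
        g e                     = proj₁ (residue-decomposition {φ e} (residue₁ e))
        φ≡χ₁+2g e               = proj₂ (residue-decomposition {φ e} (residue₁ e))
        g-circ                  = circulation-half xs {φ} {χ₁} {g} φ-circ χ₁-circ φ≡χ₁+2g
        χ₂ , χ₂-circ , residue₂ = residue-circulation xs g g-circ
    in  record { flow = χ₁ ; circulation = χ₁-circ ; trit = proj₁ ∘ residue₁ }
      , record { flow = χ₂ ; circulation = χ₂-circ ; trit = proj₁ ∘ residue₂ }
      , λ e → nonzero-mod-4⇒odd-digit {g = g e} (φ≢0 e) (∣φ∣≤3 e) (residue₁ e) (φ≡χ₁+2g e) (residue₂ e)

  private
    covering-sum : ∀ p q → p ≡ 1ℙ ⊎ q ≡ 1ℙ →
                   (p ≡ 1ℙ ⊎ p ℙ.+ q ≡ 1ℙ) × (q ≡ 1ℙ ⊎ p ℙ.+ q ≡ 1ℙ)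
    covering-sum 1ℙ 1ℙ _         = inj₁ refl , inj₁ refl
    covering-sum 1ℙ 0ℙ _         = inj₁ refl , inj₂ refl
    covering-sum 0ℙ 1ℙ _         = inj₂ refl , inj₁ refl
    covering-sum 0ℙ 0ℙ (inj₁ ())
    covering-sum 0ℙ 0ℙ (inj₂ ())

    pairwise-products≤1 : ∀ p q → ⟦ p ℙ.* q ⟧ + ⟦ p ℙ.* (p ℙ.+ q) ⟧ + ⟦ q ℙ.* (p ℙ.+ q) ⟧ ≤ 1
    pairwise-products≤1 0ℙ 0ℙ = z≤n
    pairwise-products≤1 0ℙ 1ℙ = ≤-refl
    pairwise-products≤1 1ℙ 0ℙ = ≤-refl
    pairwise-products≤1 1ℙ 1ℙ = ≤-refl

  third-circulation : (χ₁ χ₂ : TritCirculation xs) → Covering χ₁ χ₂ →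
                      Σ (TritCirculation xs) λ χ₃ → Covering χ₁ χ₃ × Covering χ₂ χ₃ ×
                        joint-support χ₁ χ₂ + joint-support χ₁ χ₃ + joint-support χ₂ χ₃ ≤ length xs
  third-circulation {xs = xs} χ₁ χ₂ covering =
    χ₃ , (λ e → covers e (proj₁ (covering-sum (p₁ e) (p₂ e) (covering e))))
       , (λ e → covers e (proj₂ (covering-sum (p₁ e) (p₂ e) (covering e))))
       , joint-supports≤
    where
    p₁ p₂ : Fin (length xs) → Parity
    p₁ e = parityℤ (flow χ₁ e)
    p₂ e = parityℤ (flow χ₂ e)
    lift = residue-circulation xs (λ e → flow χ₁ e ℤ.+ flow χ₂ e)
                               (circulation-+ xs {flow χ₁} {flow χ₂} (circulation χ₁) (circulation χ₂))
    χ₃ : TritCirculation xs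
    χ₃ = record { flow = proj₁ lift ; circulation = proj₁ (proj₂ lift) ; trit = proj₁ ∘ proj₂ (proj₂ lift) }
    p₃≡p₁+p₂ : ∀ e → parityℤ (flow χ₃ e) ≡ p₁ e ℙ.+ p₂ e
    p₃≡p₁+p₂ e = trans (proj₂ (proj₂ (proj₂ lift) e)) (parityℤ-+ (flow χ₁ e) (flow χ₂ e))
    covers : ∀ {p} e → p ≡ 1ℙ ⊎ p₁ e ℙ.+ p₂ e ≡ 1ℙ → p ≡ 1ℙ ⊎ parityℤ (flow χ₃ e) ≡ 1ℙ
    covers e = subst (λ r → _ ⊎ r ≡ 1ℙ) (sym (p₃≡p₁+p₂ e))
    a b c : Fin (length xs) → ℕ
    a e = ⟦ p₁ e ℙ.* p₂ e ⟧
    b e = ⟦ p₁ e ℙ.* parityℤ (flow χ₃ e) ⟧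
    c e = ⟦ p₂ e ℙ.* parityℤ (flow χ₃ e) ⟧
    a+b+c≤1 : ∀ e → a e + b e + c e ≤ 1
    a+b+c≤1 e = subst (λ r → a e + ⟦ p₁ e ℙ.* r ⟧ + ⟦ p₂ e ℙ.* r ⟧ ≤ 1) (sym (p₃≡p₁+p₂ e))
                      (pairwise-products≤1 (p₁ e) (p₂ e))
    joint-supports≤ : ℕΣ.sum a + ℕΣ.sum b + ℕΣ.sum c ≤ length xs
    joint-supports≤ = begin
      ℕΣ.sum a + ℕΣ.sum b + ℕΣ.sum c       ≡⟨ cong (_+ ℕΣ.sum c) (ℕΣ.∑-distrib-+ a b) ⟨
      ℕΣ.sum (λ e → a e + b e) + ℕΣ.sum c  ≡⟨ ℕΣ.∑-distrib-+ (λ e → a e + b e) c ⟨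
      ℕΣ.sum (λ e → a e + b e + c e)       ≤⟨ sum-≤-* a+b+c≤1 ⟩
      length xs * 1                        ≡⟨ *-identityʳ (length xs) ⟩
      length xs                            ∎
      where open ≤-Reasoning

  RemovableSet : ℕ → Graph → Set
  RemovableSet k G = Σ (Subset (length (edges G))) (Removable k G)

  private
    zeros-of-sum-and-difference : ∀ {a b} → Trit a → Trit b → parityℤ a ≡ 1ℙ ⊎ parityℤ b ≡ 1ℙ →
      (if isZero (a ℤ.+ b) then 1 else 0) + (if isZero (a ℤ.- b) then 1 else 0) ≤ ⟦ parityℤ a ℙ.* parityℤ b ⟧
    zeros-of-sum-and-difference 0ᵗ  0ᵗ  (inj₁ ())
    zeros-of-sum-and-difference 0ᵗ  0ᵗ  (inj₂ ())
    zeros-of-sum-and-difference 0ᵗ  +1ᵗ _ = ≤-refl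
    zeros-of-sum-and-difference 0ᵗ  -1ᵗ _ = ≤-refl
    zeros-of-sum-and-difference +1ᵗ 0ᵗ  _ = ≤-refl
    zeros-of-sum-and-difference +1ᵗ +1ᵗ _ = ≤-refl
    zeros-of-sum-and-difference +1ᵗ -1ᵗ _ = ≤-refl
    zeros-of-sum-and-difference -1ᵗ 0ᵗ  _ = ≤-refl
    zeros-of-sum-and-difference -1ᵗ +1ᵗ _ = ≤-refl
    zeros-of-sum-and-difference -1ᵗ -1ᵗ _ = ≤-refl

  sum-or-difference-removable : ∀ G (α β : TritCirculation (edges G)) → Covering α β →
                                Σ (RemovableSet 3 G) λ R → 2 * size R ≤ joint-support α β
  sum-or-difference-removable G α β covering = best , (begin
    2 * size best               ≤⟨ below-average size R₊ (R₋ ∷ []) ⟩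
    size R₊ + (size R₋ + 0)     ≡⟨ cong (size R₊ +_) (+-identityʳ (size R₋)) ⟩
    ∣ zeros φ₊ ∣ + ∣ zeros φ₋ ∣ ≡⟨ cong₂ _+_ (∣tabulate∣ (isZero ∘ φ₊)) (∣tabulate∣ (isZero ∘ φ₋)) ⟩
    ℕΣ.sum z₊ + ℕΣ.sum z₋       ≡⟨ ℕΣ.∑-distrib-+ z₊ z₋ ⟨
    ℕΣ.sum (λ e → z₊ e + z₋ e)  ≤⟨ sum-mono-≤ z₊+z₋≤ ⟩
    joint-support α β           ∎)
    where
    open ≤-Reasoning
    φ₊ φ₋ : E G → ℤ
    φ₊ e = flow α e ℤ.+ flow β e
    φ₋ e = flow α e ℤ.- flow β e
    z₊ z₋ : E G → ℕ
    z₊ e = if isZero (φ₊ e) then 1 else 0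
    z₋ e = if isZero (φ₋ e) then 1 else 0
    z₊+z₋≤ : ∀ e → z₊ e + z₋ e ≤ ⟦ parityℤ (flow α e) ℙ.* parityℤ (flow β e) ⟧
    z₊+z₋≤ e = zeros-of-sum-and-difference (trit α e) (trit β e) (covering e)
    R₊ R₋ best : RemovableSet 3 G
    R₊ = zeros φ₊ , zeros-removable 3 G φ₊
           (circulation-+ (edges G) {flow α} {flow β} (circulation α) (circulation β))
           (λ e → ∣trit+trit∣≤2 (trit α e) (trit β e))
    R₋ = zeros φ₋ , zeros-removable 3 G φ₋
           (circulation-− (edges G) {flow α} {flow β} (circulation α) (circulation β))
           (λ e → ∣trit+trit∣≤2 (trit α e) (trit-neg (trit β e)))
    best = argmin size R₊ (R₋ ∷ [])

open import Defs
open import Data.Nat using (_≤_; _*_)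
open import Data.List using (length)
open import Data.Fin.Subset using (Subset; ∣_∣)
open import Data.Product using (Σ; _×_; _,_)
open Circulations using (nzf-along-reference)
open Selection using (smallest-of-three)
open Covering

theorem1p2 : (G : Graph) → HasNZF 4 G →
    Σ (Subset (length (edges G))) (λ R → Removable 3 G R × 6 * ∣ R ∣ ≤ length (edges G))
theorem1p2 G (hasNZF _ _ nzf) =
  let φ-circ , φ≢0 , ∣φ∣≤3 = nzf-along-reference nzf
      χ₁ , χ₂ , cover₁₂     = two-digit-decomposition φ-circ φ≢0 ∣φ∣≤3
      χ₃ , cover₁₃ , cover₂₃ , joint-supports≤m = third-circulation χ₁ χ₂ cover₁₂
      R₁₂ , 2∣R₁₂∣≤ = sum-or-difference-removable G χ₁ χ₂ cover₁₂
      R₁₃ , 2∣R₁₃∣≤ = sum-or-difference-removable G χ₁ χ₃ cover₁₃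
      R₂₃ , 2∣R₂₃∣≤ = sum-or-difference-removable G χ₂ χ₃ cover₂₃
      (R , R-removable) , 6∣R∣≤m =
        smallest-of-three R₁₂ R₁₃ R₂₃ 2∣R₁₂∣≤ 2∣R₁₃∣≤ 2∣R₂₃∣≤ joint-supports≤m
  in  R , R-removable , 6∣R∣≤m
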